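{- Let $\mu=(\mu_1,\dots,\mu_k)\vdash n$ and $a\vDash n$ with $\mu\unrhd\lambda(a)$. Then $$R(\mu,a)=\{i: l(\mu,a)\le i\le k,\ \mu_i>\mu_{i+1}\}.$$
   Context: A composition $a=(a_1,\dots,a_h)\vDash n$ is a sequence of positive integers summing to $n$; a partition $\mu\vdash n$ is a non-increasing composition, with $\mu_i=0$ beyond its parts and trailing zeros deleted. For compositions $a=(a_1,\dots,a_h)$, $b=(b_1,\dots,b_k)$ of $n$, $a\unrhd b$ means $k\ge h$ and $\sum_{i=1}^j a_i\ge\sum_{i=1}^jb_i$ for $j=1,\dots,h$. $\lambda(a)$ is the non-increasing rearrangement of $a$; $\tilde a=(a_1,\dots,a_{h-1},a_h-1)$ if $a_h\ge2$ and $\tilde a=(a_1,\dots,a_{h-1})$ if $a_h=1$. $\mu^{(i)}$ is $\mu$ with its $i$-th entry decreased by $1$. $R(\mu,a)$ is the set of $i\in\{1,\dots,k\}$ with $\mu_i>\mu_{i+1}$ and $\mu^{(i)}\unrhd\lambda(\tilde a)$; $l(\mu,a)=\min R(\mu,a)$. -}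

module Defs where

open import Data.Nat using (ℕ; zero; suc; _+_; _∸_; _≤_; _<_; _≥_; _≤ᵇ_)
open import Data.Bool using (if_then_else_)
open import Data.List using (List; []; _∷_; take; length)
open import Data.Nat.ListAction using (sum)
open import Data.List.Relation.Unary.All using (All)
open import Data.List.Relation.Unary.Linked using (Linked)
open import Data.Product using (_×_)
open import Relation.Binary.PropositionalEquality using (_≡_)

IsComposition : ℕ → List ℕ → Set
IsComposition n a = All (λ x → 0 < x) a × sum a ≡ n

IsPartition : ℕ → List ℕ → Set
IsPartition n μ = IsComposition n μ × Linked _≥_ μ

-- 1-based entry access, with value 0 beyond the parts (and at index 0)
get : List ℕ → ℕ → ℕ
get []       _             = 0
get (x ∷ xs) zero          = 0
get (x ∷ xs) (suc zero)    = x
get (x ∷ xs) (suc (suc i)) = get xs (suc i)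

prefixSum : List ℕ → ℕ → ℕ
prefixSum a j = sum (take j a)

Dominates : List ℕ → List ℕ → Set
Dominates a b = length a ≤ length b
              × (∀ j → 1 ≤ j → j ≤ length a → prefixSum b j ≤ prefixSum a j)

insertDesc : ℕ → List ℕ → List ℕ
insertDesc x []       = x ∷ []
insertDesc x (y ∷ ys) = if y ≤ᵇ x then x ∷ y ∷ ys else y ∷ insertDesc x ys

sortDesc : List ℕ → List ℕ
sortDesc []       = []
sortDesc (x ∷ xs) = insertDesc x (sortDesc xs)

tilde : List ℕ → List ℕ
tilde []                     = []
tilde (zero ∷ [])            = []
tilde (suc zero ∷ [])        = []
tilde (suc (suc m) ∷ [])     = suc m ∷ []
tilde (x ∷ y ∷ ys)           = x ∷ tilde (y ∷ ys)

decAt : List ℕ → ℕ → List ℕ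
decAt []       _             = []
decAt (x ∷ xs) zero          = x ∷ xs
decAt (x ∷ xs) (suc zero)    = (x ∸ 1) ∷ xs
decAt (x ∷ xs) (suc (suc i)) = x ∷ decAt xs (suc i)

dropTrailingZeros : List ℕ → List ℕ
dropTrailingZeros []       = []
dropTrailingZeros (x ∷ xs) with dropTrailingZeros xs
... | []       = if x ≤ᵇ 0 then [] else x ∷ []
... | (y ∷ ys) = x ∷ y ∷ ys

decPart : List ℕ → ℕ → List ℕ
decPart μ i = dropTrailingZeros (decAt μ i)

IsCorner : List ℕ → ℕ → Set
IsCorner μ i = 1 ≤ i × i ≤ length μ × get μ (suc i) < get μ i

InR : List ℕ → List ℕ → ℕ → Set
InR μ a i = IsCorner μ i × Dominates (decPart μ i) (sortDesc (tilde a))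

IsMinR : List ℕ → List ℕ → ℕ → Set
IsMinR μ a l = InR μ a l × (∀ i → InR μ a i → l ≤ i)

-- Let S = λ(ã). For a corner i the sum of μ^{(i)} is n − 1 = sum S, and μ^{(i)} has no
-- trailing zeros, so μ^{(i)} ⊵ S amounts to the prefix-sum inequalities alone: were μ^{(i)}
-- longer than S, its prefix of length |S| would have sum < n − 1. Moving the removed box to a later
-- corner j ≥ i only raises prefix sums, so R(μ,a) is upward closed among the corners, and
-- R(μ,a) = {corners ≥ l} once it has a least element l. It is nonempty because k ∈ R: before
-- position k the prefix sums of μ^{(k)} are those of μ, which dominate λ(a) and hence λ(ã)
-- (entrywise λ(ã) ≤ λ(a)); from k on they equal n − 1.

module Submission where

open import Defs
open import Data.Bool using (true; false)
open import Data.Empty using (⊥-elim)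
open import Data.List using (List; []; _∷_; _++_; take; drop; length)
open import Data.List.Properties using (take-all; take-[]; take++drop≡id)
open import Data.List.Relation.Binary.Prefix.Heterogeneous using (Prefix; []; _∷_)
open import Data.List.Relation.Unary.All as All using (All; []; _∷_)
open import Data.List.Relation.Unary.AllPairs using (AllPairs; []; _∷_)
open import Data.Nat using (ℕ; zero; suc; _+_; _≤_; _<_; _≥_; _≤ᵇ_; z≤n; s≤s; _≤?_; _<?_)
open import Data.Nat.Induction using (<-rec)
open import Data.Nat.ListAction using (sum)
open import Data.Nat.ListAction.Properties using (sum-++)
open import Data.Nat.Properties
open import Data.Product using (Σ; _×_; _,_; proj₁)
open import Data.Sum using (inj₁; inj₂)
open import Function.Base using (_$_)
open import Function.Bundles using (_⇔_; mk⇔; Equivalence)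
open import Relation.Nullary using (Dec; yes; no)
open import Relation.Nullary.Decidable using (_×-dec_; map′)
open import Relation.Nullary.Reflects using (ofʸ; ofⁿ)
open import Relation.Unary using (Pred; Decidable)
open import Relation.Binary.PropositionalEquality using (_≡_; refl; sym; trans; cong; subst; module ≡-Reasoning)
open import Algebra.Properties.CommutativeSemigroup +-commutativeSemigroup using (x∙yz≈y∙xz)

least-witness : ∀ {p} {P : Pred ℕ p} → Decidable P → ∀ {m} → P m →
                Σ ℕ λ l → P l × (∀ i → P i → l ≤ i)
least-witness {P = P} P? {m} = <-rec (λ m → P m → Σ ℕ λ l → P l × (∀ i → P i → l ≤ i)) step m
  where
  step : ∀ m → (∀ {i} → i < m → P i → Σ ℕ λ l → P l × (∀ i → P i → l ≤ i)) →
         P m → Σ ℕ λ l → P l × (∀ i → P i → l ≤ i)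
  step m below Pm with anyUpTo? P? m
  ... | yes (i , i<m , Pi) = below i<m Pi
  ... | no none            = m , Pm , λ i Pi → ≮⇒≥ λ i<m → none (i , i<m , Pi)

least-upward-closed : ∀ {p q} {P : Pred ℕ p} {Q : Pred ℕ q} → Decidable P →
                      (∀ {i} → P i → Q i) → (∀ {i j} → P i → i ≤ j → Q j → P j) →
                      ∀ {m} → P m →
                      Σ ℕ λ l → (P l × (∀ i → P i → l ≤ i)) × (∀ i → P i ⇔ (l ≤ i × Q i))
least-upward-closed P? P⊆Q upward Pm with least-witness P? Pm
... | l , Pl , least = l , (Pl , least) , λ i →
  mk⇔ (λ Pi → least i Pi , P⊆Q Pi) (λ (l≤i , Qi) → upward Pl l≤i Qi)

prefixSum≤sum : ∀ xs p → prefixSum xs p ≤ sum xs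
prefixSum≤sum xs p = begin
  prefixSum xs p                         ≤⟨ m≤m+n _ _ ⟩
  sum (take p xs) + sum (drop p xs)      ≡⟨ sum-++ (take p xs) (drop p xs) ⟨
  sum (take p xs ++ drop p xs)           ≡⟨ cong sum (take++drop≡id p xs) ⟩
  sum xs                                 ∎
  where open ≤-Reasoning

prefixSum-all : ∀ xs {p} → length xs ≤ p → prefixSum xs p ≡ sum xs
prefixSum-all xs {p} le = cong sum (take-all p xs le)

prefixSum-mono : ∀ {xs ys} → Prefix _≤_ xs ys → ∀ p → prefixSum xs p ≤ prefixSum ys p
prefixSum-mono []           zero    = z≤n
prefixSum-mono []           (suc p) = z≤n
prefixSum-mono (x≤y ∷ xs≤ys) zero    = z≤n
prefixSum-mono (x≤y ∷ xs≤ys) (suc p) = +-mono-≤ x≤y (prefixSum-mono xs≤ys p)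

PrefixDominates : List ℕ → List ℕ → Set
PrefixDominates xs ys = ∀ p → prefixSum ys p ≤ prefixSum xs p

Dominates⇒prefixSum≤ : ∀ {xs ys p} → Dominates xs ys → p ≤ length xs → prefixSum ys p ≤ prefixSum xs p
Dominates⇒prefixSum≤ {p = zero}  _          _  = z≤n
Dominates⇒prefixSum≤ {p = suc p} (_ , dom) le = dom (suc p) (s≤s z≤n) le

Dominates⇒PrefixDominates : ∀ {xs ys} → sum ys ≤ sum xs → Dominates xs ys → PrefixDominates xs ys
Dominates⇒PrefixDominates {xs} {ys} Σys≤Σxs xs⊵ys p with ≤-<-connex p (length xs)
... | inj₁ p≤len = Dominates⇒prefixSum≤ xs⊵ys p≤len
... | inj₂ len<p = begin
  prefixSum ys p  ≤⟨ prefixSum≤sum ys p ⟩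
  sum ys          ≤⟨ Σys≤Σxs ⟩
  sum xs          ≡⟨ prefixSum-all xs (<⇒≤ len<p) ⟨
  prefixSum xs p  ∎
  where open ≤-Reasoning

-- The first hypothesis (xs has no trailing zeros) forces the length condition.
PrefixDominates⇒Dominates : ∀ {xs ys} → (∀ s → s < length xs → prefixSum xs s < sum xs) →
                            sum xs ≤ sum ys → PrefixDominates xs ys → Dominates xs ys
PrefixDominates⇒Dominates {xs} {ys} no-trailing-zeros Σxs≤Σys xs≽ys = length≤ , λ p _ _ → xs≽ys p
  where
  length≤ : length xs ≤ length ys
  length≤ with ≤-<-connex (length xs) (length ys)
  ... | inj₁ le     = le
  ... | inj₂ ys<xs  = ⊥-elim (<⇒≱ (no-trailing-zeros (length ys) ys<xs) (begin
    sum xs                         ≤⟨ Σxs≤Σys ⟩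
    sum ys                         ≡⟨ prefixSum-all ys ≤-refl ⟨
    prefixSum ys (length ys)       ≤⟨ xs≽ys (length ys) ⟩
    prefixSum xs (length ys)       ∎))
    where open ≤-Reasoning

prefixSum-dropTrailingZeros : ∀ xs p → prefixSum (dropTrailingZeros xs) p ≡ prefixSum xs p
prefixSum-dropTrailingZeros []       p = refl
prefixSum-dropTrailingZeros (x ∷ xs) zero with dropTrailingZeros xs
... | []     = refl
... | _ ∷ _  = refl
prefixSum-dropTrailingZeros (x ∷ xs) (suc p)
  with dropTrailingZeros xs | prefixSum-dropTrailingZeros xs p
... | []    | eq with x
...   | zero  = trans (sym (cong sum (take-[] p))) eq
...   | suc x′ = cong (suc x′ +_) eq
prefixSum-dropTrailingZeros (x ∷ xs) (suc p) | _ ∷ _ | eq = cong (x +_) eq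

sum-dropTrailingZeros : ∀ xs → sum (dropTrailingZeros xs) ≡ sum xs
sum-dropTrailingZeros []       = refl
sum-dropTrailingZeros (x ∷ xs) with dropTrailingZeros xs | sum-dropTrailingZeros xs
... | []    | eq with x
...   | zero  = eq
...   | suc x′ = cong (suc x′ +_) eq
sum-dropTrailingZeros (x ∷ xs) | _ ∷ _ | eq = cong (x +_) eq

prefixSum<sum-dropTrailingZeros : ∀ xs s → s < length (dropTrailingZeros xs) →
                                  prefixSum (dropTrailingZeros xs) s < sum (dropTrailingZeros xs)
prefixSum<sum-dropTrailingZeros (x ∷ xs) s s<len
  with dropTrailingZeros xs | prefixSum<sum-dropTrailingZeros xs
... | []     | _ with x | s | s<len
...   | zero  | _      | ()
...   | suc _ | zero   | _         = s≤s z≤n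
...   | suc _ | suc _  | s≤s ()
prefixSum<sum-dropTrailingZeros (x ∷ xs) s s<len | y ∷ ys | ih with s | s<len
... | zero   | _         = <-≤-trans (ih 0 (s≤s z≤n)) (m≤n+m _ x)
... | suc s′ | s≤s s′<len = +-monoʳ-< x (ih s′ s′<len)

Dominates-dropTrailingZeros⇔ : ∀ xs {ys} → sum xs ≡ sum ys →
                               Dominates (dropTrailingZeros xs) ys ⇔ PrefixDominates xs ys
Dominates-dropTrailingZeros⇔ xs {ys} Σxs≡Σys = mk⇔
  (λ ⊵ p → subst (prefixSum ys p ≤_) (prefixSum-dropTrailingZeros xs p)
                 (Dominates⇒PrefixDominates (≤-reflexive (sym Σ≡)) ⊵ p))
  (λ ≽ → PrefixDominates⇒Dominates (prefixSum<sum-dropTrailingZeros xs) (≤-reflexive Σ≡)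
           λ p → subst (prefixSum ys p ≤_) (sym (prefixSum-dropTrailingZeros xs p)) (≽ p))
  where
  Σ≡ : sum (dropTrailingZeros xs) ≡ sum ys
  Σ≡ = trans (sum-dropTrailingZeros xs) Σxs≡Σys

length-decAt : ∀ xs i → length (decAt xs i) ≡ length xs
length-decAt []       i             = refl
length-decAt (x ∷ xs) zero          = refl
length-decAt (x ∷ xs) (suc zero)    = refl
length-decAt (x ∷ xs) (suc (suc i)) = cong suc (length-decAt xs (suc i))

sum-decAt : ∀ xs i → 0 < get xs i → suc (sum (decAt xs i)) ≡ sum xs
sum-decAt (suc x ∷ xs) (suc zero)    _   = refl
sum-decAt (x ∷ xs)     (suc (suc i)) pos =
  trans (sym (+-suc x _)) (cong (x +_) (sum-decAt xs (suc i) pos))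

prefixSum-decAt-< : ∀ xs {i p} → p < i → prefixSum (decAt xs i) p ≡ prefixSum xs p
prefixSum-decAt-< []       _                 = refl
prefixSum-decAt-< (x ∷ xs) {p = zero}  _     = refl
prefixSum-decAt-< (x ∷ xs) {suc (suc i)} {suc p} (s≤s p<i) =
  cong (x +_) (prefixSum-decAt-< xs p<i)

prefixSum≤1+prefixSum-decAt : ∀ xs i p → prefixSum xs p ≤ suc (prefixSum (decAt xs i) p)
prefixSum≤1+prefixSum-decAt []           i             p       = n≤1+n _
prefixSum≤1+prefixSum-decAt (x ∷ xs)     i             zero    = z≤n
prefixSum≤1+prefixSum-decAt (x ∷ xs)     zero          (suc p) = n≤1+n _
prefixSum≤1+prefixSum-decAt (zero ∷ xs)  (suc zero)    (suc p) = n≤1+n _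
prefixSum≤1+prefixSum-decAt (suc x ∷ xs) (suc zero)    (suc p) = ≤-refl
prefixSum≤1+prefixSum-decAt (x ∷ xs)     (suc (suc i)) (suc p) = begin
  x + prefixSum xs p                            ≤⟨ +-monoʳ-≤ x (prefixSum≤1+prefixSum-decAt xs (suc i) p) ⟩
  x + suc (prefixSum (decAt xs (suc i)) p)      ≡⟨ +-suc x _ ⟩
  suc (x + prefixSum (decAt xs (suc i)) p)      ∎
  where open ≤-Reasoning

PrefixDominates-decAt : ∀ xs {i j} → 1 ≤ i → i ≤ j → 0 < get xs i →
                        PrefixDominates (decAt xs j) (decAt xs i)
PrefixDominates-decAt []       _ _ _ p = ≤-refl
PrefixDominates-decAt (x ∷ xs) _ _ _ zero = z≤n
PrefixDominates-decAt (x ∷ xs) {suc zero} {suc zero} _ _ _ (suc p) = ≤-refl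
PrefixDominates-decAt (suc x ∷ xs) {suc zero} {suc (suc j)} _ _ _ (suc p) = begin
  x + prefixSum xs p                            ≤⟨ +-monoʳ-≤ x (prefixSum≤1+prefixSum-decAt xs (suc j) p) ⟩
  x + suc (prefixSum (decAt xs (suc j)) p)      ≡⟨ +-suc x _ ⟩
  suc x + prefixSum (decAt xs (suc j)) p        ∎
  where open ≤-Reasoning
PrefixDominates-decAt (x ∷ xs) {suc (suc i)} {suc (suc j)} _ (s≤s i≤j) pos (suc p) =
  +-monoʳ-≤ x (PrefixDominates-decAt xs (s≤s z≤n) i≤j pos p)

Descending : List ℕ → Set
Descending = AllPairs _≥_

insertDesc-All : ∀ {p} {P : Pred ℕ p} {x} ys → P x → All P ys → All P (insertDesc x ys)
insertDesc-All           []       px []         = px ∷ []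
insertDesc-All {x = x} (y ∷ ys) px (py ∷ pys) with y ≤ᵇ x
... | true  = px ∷ py ∷ pys
... | false = py ∷ insertDesc-All ys px pys

insertDesc-descending : ∀ x {ys} → Descending ys → Descending (insertDesc x ys)
insertDesc-descending x {[]}     []            = [] ∷ []
insertDesc-descending x {y ∷ ys} (y≥ys ∷ ys↓) with y ≤ᵇ x | ≤ᵇ-reflects-≤ y x
... | true  | ofʸ y≤x = (y≤x ∷ All.map (λ z≤y → ≤-trans z≤y y≤x) y≥ys) ∷ y≥ys ∷ ys↓
... | false | ofⁿ y≰x = insertDesc-All ys (<⇒≤ (≰⇒> y≰x)) y≥ys ∷ insertDesc-descending x ys↓

sortDesc-descending : ∀ xs → Descending (sortDesc xs)
sortDesc-descending []       = []
sortDesc-descending (x ∷ xs) = insertDesc-descending x (sortDesc-descending xs)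

sum-insertDesc : ∀ x ys → sum (insertDesc x ys) ≡ x + sum ys
sum-insertDesc x []       = refl
sum-insertDesc x (y ∷ ys) with y ≤ᵇ x
... | true  = refl
... | false = trans (cong (y +_) (sum-insertDesc x ys)) (x∙yz≈y∙xz y x (sum ys))

sum-sortDesc : ∀ xs → sum (sortDesc xs) ≡ sum xs
sum-sortDesc []       = refl
sum-sortDesc (x ∷ xs) = trans (sum-insertDesc x (sortDesc xs)) (cong (x +_) (sum-sortDesc xs))

insertDesc-shift : ∀ x w ws zs → All (_≤ x) (w ∷ ws) → Prefix _≤_ ws zs →
                   Prefix _≤_ (w ∷ ws) (insertDesc x zs)
insertDesc-shift x w [] [] (w≤x ∷ _) [] = w≤x ∷ []
insertDesc-shift x w ws (z ∷ zs) (w≤x ∷ ws≤x) ws≤zs with z ≤ᵇ x | ≤ᵇ-reflects-≤ z x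
... | true  | _       = w≤x ∷ ws≤zs
... | false | ofⁿ z≰x with ws≤zs
...   | []                           = ≤-trans w≤x (<⇒≤ (≰⇒> z≰x)) ∷ []
...   | _∷_ {as = ws′} _ ws′≤zs =
  ≤-trans w≤x (<⇒≤ (≰⇒> z≰x)) ∷ insertDesc-shift x _ ws′ zs ws≤x ws′≤zs

insertDesc-mono : ∀ x {ys zs} → Descending ys → Prefix _≤_ ys zs →
                  Prefix _≤_ (insertDesc x ys) (insertDesc x zs)
insertDesc-mono x {zs = zs} [] [] = insertDesc-shift x x [] zs (≤-refl ∷ []) []
insertDesc-mono x {y ∷ ys} {z ∷ zs} (y≥ys ∷ ys↓) (y≤z ∷ ys≤zs)
  with y ≤ᵇ x | ≤ᵇ-reflects-≤ y x | z ≤ᵇ x | ≤ᵇ-reflects-≤ z x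
... | true  | ofʸ _   | true  | ofʸ _   = ≤-refl ∷ y≤z ∷ ys≤zs
... | true  | ofʸ y≤x | false | ofⁿ z≰x =
  <⇒≤ (≰⇒> z≰x) ∷
  insertDesc-shift x y ys zs (y≤x ∷ All.map (λ w≤y → ≤-trans w≤y y≤x) y≥ys) ys≤zs
... | false | ofⁿ y≰x | true  | ofʸ z≤x = ⊥-elim (y≰x (≤-trans y≤z z≤x))
... | false | ofⁿ _   | false | ofⁿ _   = y≤z ∷ insertDesc-mono x ys↓ ys≤zs

tilde-∷-∷ : ∀ x y ys → tilde (x ∷ y ∷ ys) ≡ x ∷ tilde (y ∷ ys)
tilde-∷-∷ zero          y ys = refl
tilde-∷-∷ (suc zero)    y ys = refl
tilde-∷-∷ (suc (suc x)) y ys = refl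

sortDesc-tilde≤sortDesc : ∀ a → Prefix _≤_ (sortDesc (tilde a)) (sortDesc a)
sortDesc-tilde≤sortDesc []                 = []
sortDesc-tilde≤sortDesc (zero ∷ [])        = []
sortDesc-tilde≤sortDesc (suc zero ∷ [])    = []
sortDesc-tilde≤sortDesc (suc (suc m) ∷ []) = n≤1+n _ ∷ []
sortDesc-tilde≤sortDesc (x ∷ y ∷ ys) =
  subst (λ t → Prefix _≤_ (sortDesc t) (sortDesc (x ∷ y ∷ ys))) (sym (tilde-∷-∷ x y ys)) $
  insertDesc-mono x (sortDesc-descending (tilde (y ∷ ys))) (sortDesc-tilde≤sortDesc (y ∷ ys))

sum-tilde : ∀ a → All (0 <_) a → 1 ≤ length a → suc (sum (tilde a)) ≡ sum a
sum-tilde (suc zero ∷ [])    _          _ = refl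
sum-tilde (suc (suc m) ∷ []) _          _ = refl
sum-tilde (x ∷ y ∷ ys)       (_ ∷ pos) _ rewrite tilde-∷-∷ x y ys =
  trans (sym (+-suc x _)) (cong (x +_) (sum-tilde (y ∷ ys) pos (s≤s z≤n)))

get-beyond : ∀ xs → get xs (suc (length xs)) ≡ 0
get-beyond []       = refl
get-beyond (x ∷ xs) = get-beyond xs

get-last : ∀ {xs} → All (0 <_) xs → 1 ≤ length xs → 0 < get xs (length xs)
get-last {x ∷ []}     (x>0 ∷ _) _ = x>0
get-last {x ∷ y ∷ ys} (_ ∷ pos) _ = get-last pos (s≤s z≤n)

1≤sum⇒1≤length : ∀ xs → 1 ≤ sum xs → 1 ≤ length xs
1≤sum⇒1≤length (x ∷ xs) _ = s≤s z≤n

IsCorner⇒0<get : ∀ μ {i} → IsCorner μ i → 0 < get μ i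
IsCorner⇒0<get _ (_ , _ , descent) = ≤-<-trans z≤n descent

IsCorner-length : ∀ {μ} → All (0 <_) μ → 1 ≤ length μ → IsCorner μ (length μ)
IsCorner-length {μ} pos 1≤k =
  1≤k , ≤-refl , subst (_< get μ (length μ)) (sym (get-beyond μ)) (get-last pos 1≤k)

PrefixDominates-decAt-length : ∀ {μ ν ys} → Dominates μ ν → PrefixDominates ν ys →
                               suc (sum ys) ≡ sum μ → 0 < get μ (length μ) →
                               PrefixDominates (decAt μ (length μ)) ys
PrefixDominates-decAt-length {μ} {ν} {ys} μ⊵ν ν≽ys Σys≡Σμ-1 pos p with <-≤-connex p (length μ)
... | inj₁ p<k = begin
  prefixSum ys p                   ≤⟨ ν≽ys p ⟩
  prefixSum ν p                    ≤⟨ Dominates⇒prefixSum≤ μ⊵ν (<⇒≤ p<k) ⟩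
  prefixSum μ p                    ≡⟨ prefixSum-decAt-< μ p<k ⟨
  prefixSum (decAt μ (length μ)) p ∎
  where open ≤-Reasoning
... | inj₂ k≤p = begin
  prefixSum ys p                   ≤⟨ prefixSum≤sum ys p ⟩
  sum ys                           ≡⟨ suc-injective (trans Σys≡Σμ-1 (sym (sum-decAt μ (length μ) pos))) ⟩
  sum (decAt μ (length μ))         ≡⟨ prefixSum-all (decAt μ (length μ)) len≤p ⟨
  prefixSum (decAt μ (length μ)) p ∎
  where
  open ≤-Reasoning
  len≤p : length (decAt μ (length μ)) ≤ p
  len≤p = ≤-trans (≤-reflexive (length-decAt μ (length μ))) k≤p

decPart-Dominates⇔ : ∀ μ i {ys} → 0 < get μ i → suc (sum ys) ≡ sum μ →
                     Dominates (decPart μ i) ys ⇔ PrefixDominates (decAt μ i) ys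
decPart-Dominates⇔ μ i pos Σys≡Σμ-1 =
  Dominates-dropTrailingZeros⇔ (decAt μ i) (suc-injective (trans (sum-decAt μ i pos) (sym Σys≡Σμ-1)))

Dominates-decPart-upward : ∀ μ {ys i j} → suc (sum ys) ≡ sum μ →
                           IsCorner μ i → Dominates (decPart μ i) ys → i ≤ j → IsCorner μ j →
                           Dominates (decPart μ j) ys
Dominates-decPart-upward μ Σys≡Σμ-1 ci@(1≤i , _) μ⁽ⁱ⁾⊵ys i≤j cj =
  Equivalence.from (decPart-Dominates⇔ μ _ (IsCorner⇒0<get μ cj) Σys≡Σμ-1) λ p → ≤-trans
    (Equivalence.to (decPart-Dominates⇔ μ _ (IsCorner⇒0<get μ ci) Σys≡Σμ-1) μ⁽ⁱ⁾⊵ys p)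
    (PrefixDominates-decAt μ 1≤i i≤j (IsCorner⇒0<get μ ci) p)

Dominates-decPart-length : ∀ {μ ν ys} → All (0 <_) μ → 1 ≤ length μ → suc (sum ys) ≡ sum μ →
                           Dominates μ ν → PrefixDominates ν ys → Dominates (decPart μ (length μ)) ys
Dominates-decPart-length {μ} pos 1≤k Σys≡Σμ-1 μ⊵ν ν≽ys =
  Equivalence.from (decPart-Dominates⇔ μ (length μ) (get-last pos 1≤k) Σys≡Σμ-1)
    (PrefixDominates-decAt-length μ⊵ν ν≽ys Σys≡Σμ-1 (get-last pos 1≤k))

Dominates? : ∀ xs ys → Dec (Dominates xs ys)
Dominates? xs ys = length xs ≤? length ys ×-dec
  map′ shift unshift (allUpTo? (λ j → prefixSum ys (suc j) ≤? prefixSum xs (suc j)) (length xs))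
  where
  shift : (∀ {j} → j < length xs → prefixSum ys (suc j) ≤ prefixSum xs (suc j)) →
          ∀ j → 1 ≤ j → j ≤ length xs → prefixSum ys j ≤ prefixSum xs j
  shift below (suc j) _ j<len = below j<len
  unshift : (∀ j → 1 ≤ j → j ≤ length xs → prefixSum ys j ≤ prefixSum xs j) →
            ∀ {j} → j < length xs → prefixSum ys (suc j) ≤ prefixSum xs (suc j)
  unshift below j<len = below _ (s≤s z≤n) j<len

InR? : ∀ μ a → Decidable (InR μ a)
InR? μ a i = (1 ≤? i ×-dec (i ≤? length μ ×-dec get μ (suc i) <? get μ i)) ×-dec
             Dominates? (decPart μ i) (sortDesc (tilde a))

lemma5p1 : (n : ℕ) (μ a : List ℕ) → 1 ≤ n → IsPartition n μ → IsComposition n a →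
    Dominates μ (sortDesc a) →
    Σ ℕ (λ l → IsMinR μ a l ×
    (∀ i → InR μ a i ⇔ (l ≤ i × IsCorner μ i)))
lemma5p1 n μ a 1≤n ((μ>0 , Σμ≡n) , _) (a>0 , Σa≡n) μ⊵λa =
  least-upward-closed (InR? μ a) proj₁
    (λ (ci , i∈R) i≤j cj → cj , Dominates-decPart-upward μ Σλã≡Σμ-1 ci i∈R i≤j cj)
    ( IsCorner-length μ>0 1≤k
    , Dominates-decPart-length μ>0 1≤k Σλã≡Σμ-1 μ⊵λa (prefixSum-mono (sortDesc-tilde≤sortDesc a)))
  where
  1≤k : 1 ≤ length μ
  1≤k = 1≤sum⇒1≤length μ (subst (1 ≤_) (sym Σμ≡n) 1≤n)
  Σλã≡Σμ-1 : suc (sum (sortDesc (tilde a))) ≡ sum μ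
  Σλã≡Σμ-1 = begin
    suc (sum (sortDesc (tilde a))) ≡⟨ cong suc (sum-sortDesc (tilde a)) ⟩
    suc (sum (tilde a))            ≡⟨ sum-tilde a a>0 (1≤sum⇒1≤length a (subst (1 ≤_) (sym Σa≡n) 1≤n)) ⟩
    sum a                          ≡⟨ trans Σa≡n (sym Σμ≡n) ⟩
    sum μ                          ∎
    where open ≡-Reasoning
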